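{- Let $G=(V,E)$ be a finite connected simple graph with $n=|V|$ nodes which is $(q+1)$-regular. Then, as an identity in the variable $u$, \[ \omega_G(u^2)=\alpha_G\!\left(\frac{1}{u}+qu\right)u^{n}. \]
   Context: The polynomials $f_n$ are defined by $f_0(x)=1$, $f_1(x)=0$, $f_{n+1}(x)=xf_n(x)+f_{n-1}(x)$. $\theta_G(\beta,\xi)=\sum_{s\subset E}\beta^{|s|}\prod_{i\in V}f_{d_i(s)}(\xi-\xi^{ -1})$, where $d_i(s)$ is the number of edges of $s$ incident to $i$, and $\omega_G(\beta)=\theta_G(\beta,\sqrt{ -1})/(1-\beta)^{|E|-|V|}$ (a polynomial in $\beta$), where $\theta_G(\beta,\sqrt{ -1})$ means substituting $\xi=\sqrt{ -1}$, i.e. $\xi-\xi^{ -1}=2\sqrt{ -1}$. A $k$-matching of $G$ is a set of $k$ edges no two of which share a node; $p_G(k)$ is the number of $k$-matchings, and the matching polynomial is $\alpha_G(x)=\sum_{k=0}^{\lfloor n/2\rfloor}(-1)^kp_G(k)x^{n-2k}$. -}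

module Defs where

open import Data.Bool using (Bool; true; false; _∧_; _∨_; if_then_else_)
open import Data.Nat as ℕ using (ℕ; zero; suc; ⌊_/2⌋; _∸_)
open import Data.Integer as ℤ using (ℤ; +_; -[1+_])
open import Data.Rational as ℚ using (ℚ; 0ℚ; 1ℚ; ≢-nonZero)
open import Data.Rational.Properties using () renaming (_≟_ to _≟ℚ_)
open import Data.Fin using (Fin; toℕ)
open import Data.Fin.Properties using () renaming (_≟_ to _≟F_)
open import Data.List using (List; []; _∷_; _++_; map; filter; length; concatMap; allFin; foldr; upTo)
open import Data.Product using (_×_; _,_; proj₁; proj₂)
open import Relation.Nullary using (yes; no; does)
open import Relation.Binary.PropositionalEquality using (_≡_)

-- Gaussian rationals  ℚ(√-1)  (a field of characteristic 0 containing √-1)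

record GQ : Set where
  constructor _+i_
  field
    re : ℚ
    im : ℚ
open GQ public

-- total inverse on ℚ (value at 0 is irrelevant; only used at nonzero arguments)
invℚ : ℚ → ℚ
invℚ p with p ≟ℚ 0ℚ
... | yes _ = 0ℚ
... | no p≢0 = ℚ.1/_ p {{≢-nonZero p≢0}}

infixl 6 _⊕_ _⊖_
infixl 7 _⊗_

_⊕_ : GQ → GQ → GQ
(a +i b) ⊕ (c +i d) = (a ℚ.+ c) +i (b ℚ.+ d)

⊝_ : GQ → GQ
⊝ (a +i b) = (ℚ.- a) +i (ℚ.- b)

_⊖_ : GQ → GQ → GQ
z ⊖ w = z ⊕ (⊝ w)

_⊗_ : GQ → GQ → GQ
(a +i b) ⊗ (c +i d) = ((a ℚ.* c) ℚ.- (b ℚ.* d)) +i ((a ℚ.* d) ℚ.+ (b ℚ.* c))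

-- multiplicative inverse (for z ≠ 0): (a - b i) / (a² + b²)
inv : GQ → GQ
inv (a +i b) = (a ℚ.* n⁻¹) +i ((ℚ.- b) ℚ.* n⁻¹)
  where n⁻¹ = invℚ ((a ℚ.* a) ℚ.+ (b ℚ.* b))

𝟘 𝟙 𝕚 : GQ
𝟘 = 0ℚ +i 0ℚ
𝟙 = 1ℚ +i 0ℚ
𝕚 = 0ℚ +i 1ℚ

fromℕ : ℕ → GQ
fromℕ k = (+ k ℚ./ 1) +i 0ℚ

_^_ : GQ → ℕ → GQ
z ^ zero = 𝟙
z ^ suc k = z ⊗ (z ^ k)

_^ℤ_ : GQ → ℤ → GQ
z ^ℤ (+ k) = z ^ k
z ^ℤ -[1+ k ] = inv z ^ suc k

sgn : ℕ → GQ
sgn k = (⊝ 𝟙) ^ k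

sumGQ : List GQ → GQ
sumGQ = foldr _⊕_ 𝟘

prodGQ : List GQ → GQ
prodGQ = foldr _⊗_ 𝟙

f : ℕ → GQ → GQ
f zero x = 𝟙
f (suc zero) x = 𝟘
f (suc (suc k)) x = x ⊗ f (suc k) x ⊕ f k x

record SimpleGraph (n : ℕ) : Set where
  field
    adj    : Fin n → Fin n → Bool
    adj-sym : ∀ i j → adj i j ≡ adj j i
    adj-irr : ∀ i → adj i i ≡ false
open SimpleGraph public

Edge : ℕ → Set
Edge n = Fin n × Fin n

-- the edge set E, each edge {i,j} listed once as (i , j) with i < j
edges : ∀ {n} → SimpleGraph n → List (Edge n)
edges {n} G = concatMap (λ i → concatMap (λ j →
    if adj G i j ∧ (toℕ i ℕ.<ᵇ toℕ j) then (i , j) ∷ [] else []) (allFin n)) (allFin n)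

subsets : ∀ {A : Set} → List A → List (List A)
subsets [] = [] ∷ []
subsets (x ∷ xs) = subsets xs ++ map (x ∷_) (subsets xs)

incident : ∀ {n} → Fin n → Edge n → Bool
incident i (a , b) = does (i ≟F a) ∨ does (i ≟F b)

deg : ∀ {n} → List (Edge n) → Fin n → ℕ
deg s i = length (filter (λ e → incident i e Data.Bool.≟ true) s)
  where import Data.Bool

degree : ∀ {n} → SimpleGraph n → Fin n → ℕ
degree G i = deg (edges G) i

Regular : ∀ {n} → SimpleGraph n → ℕ → Set
Regular {n} G r = (i : Fin n) → degree G i ≡ r

data Reach {n} (G : SimpleGraph n) : Fin n → Fin n → Set where
  here : ∀ {i} → Reach G i i
  step : ∀ {i j k} → adj G i j ≡ true → Reach G j k → Reach G i k

Connected : ∀ {n} → SimpleGraph n → Set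
Connected {n} G = (i j : Fin n) → Reach G i j

θ : ∀ {n} → SimpleGraph n → GQ → GQ → GQ
θ {n} G β ξ = sumGQ (map (λ s → (β ^ length s) ⊗
                 prodGQ (map (λ i → f (deg s i) (ξ ⊖ inv ξ)) (allFin n)))
               (subsets (edges G)))

-- ω_G(β) = θ_G(β, √-1) / (1 - β)^{|E| - |V|}, evaluated at β (β ≠ 1)
ω : ∀ {n} → SimpleGraph n → GQ → GQ
ω {n} G β = θ G β 𝕚 ⊗ ((𝟙 ⊖ β) ^ℤ ((+ n) ℤ.- (+ length (edges G))))

IsMatching : ∀ {n} → List (Edge n) → Bool
IsMatching {n} s = foldr _∧_ true (map (λ i → deg s i ℕ.≤ᵇ 1) (allFin n))

p : ∀ {n} → SimpleGraph n → ℕ → ℕ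
p G k = length (filter (λ s → (IsMatching s ∧ (length s ℕ.≡ᵇ k)) Data.Bool.≟ true)
                       (subsets (edges G)))
  where import Data.Bool

α : ∀ {n} → SimpleGraph n → GQ → GQ
α {n} G x = sumGQ (map (λ k → sgn k ⊗ fromℕ (p G k) ⊗ (x ^ (n ∸ (2 ℕ.* k))))
                      (upTo (suc ⌊ n /2⌋)))

module Submission where

-- At ξ = √-1 we have ξ - ξ⁻¹ = 2i and f_d(2i) = i^d (1 - d). Replace the constant 1 by a charge
-- c_v at each vertex, Θ_E(c) = Σ_{s ⊆ E} β^|s| Π_v i^{d_v(s)} (c_v - d_v(s)), so that
-- θ_G(β, i) = Θ_E(1). Splitting the subsets of e ∷ E by whether they contain e, and using
-- i² = -1, gives Θ_{e∷E}(c) = Θ_E(c) - β Θ_E(c - 1_e), where 1_e marks the ends of e.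
-- The matching sum Φ_E(A) = Σ_{matchings s ⊆ E} (-β)^|s| Π_{v uncovered} A_v, taken at the
-- charges A_v = (1 - β) c_v + d_v(E) β and scaled by (1 - β)^|E|, satisfies the same recursion
-- (by a polynomial identity in the data at the two ends of e) and agrees with (1 - β)^n Θ_E(c)
-- for E = []. For a (q+1)-regular graph and c = 1 every charge is 1 + qβ = (1/u + qu) u when
-- β = u², and grouping matchings by size identifies Φ_E with α_G(1/u + qu) u^n; dividing by
-- (1 - β)^(|E| - n) gives ω_G(u²).

open import Defs
open import Data.Nat using (ℕ; suc)
open import Relation.Binary.PropositionalEquality using (_≡_; _≢_)

open import Level using (0ℓ)
open import Function using (_∘_; id)
open import Data.Product using (_,_)
open import Data.Sum using (inj₁; inj₂)
open import Data.Empty using (⊥-elim)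
open import Relation.Nullary using (yes; no; Dec; does)
open import Relation.Binary.PropositionalEquality
  using (refl; sym; trans; cong; cong₂; _≗_; isEquivalence; module ≡-Reasoning)
open import Algebra.Bundles using (CommutativeRing; CommutativeMonoid)
open import Algebra.Structures {A = GQ} _≡_ using (IsCommutativeRing)
open import Algebra.Consequences.Propositional
  using (comm∧idˡ⇒id; comm∧invˡ⇒inv; comm∧distrˡ⇒distrʳ)
import Algebra.Solver.Ring.Simple as RingSolver
import Algebra.Solver.Ring.AlmostCommutativeRing as ACR
open import Data.Nat as ℕ using (zero; _+_; _∸_; _≤_; _<_; s≤s; ⌊_/2⌋; ⌈_/2⌉)
import Data.Nat.Properties as ℕₚ
open import Data.Integer as ℤ using (+_; -[1+_])
import Data.Integer.Properties as ℤₚ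
open import Data.Rational as ℚ using (ℚ; mkℚ; 0ℚ; 1ℚ; Positive; NonNegative)
import Data.Rational.Properties as ℚₚ
open import Data.Rational.Solver using (module +-*-Solver)
open import Data.Nat.Coprimality as Coprime using (1-coprimeTo)
open import Data.Bool as Bool using (Bool; true; false; _∧_; if_then_else_)
open import Data.Bool.Properties using (if-float; if-eta)
open import Data.Fin using (Fin; zero; suc; toℕ)
open import Data.Fin.Properties using () renaming (_≟_ to _≟F_)
open import Data.List as List using (List; []; _∷_; _++_; allFin; upTo; applyUpTo)
open import Data.List.Properties
  using (map-tabulate; map-++; map-∘; map-cong; map-cong-local; map-upTo)
open import Data.List.Relation.Unary.All as All using (All; []; _∷_)
open import Data.List.Relation.Unary.All.Properties using (++⁺; map⁺; concat⁺; all-upTo)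
import Data.Vec.Functional as Vector

-- The Gaussian rationals as a commutative ring

private
  _+i-cong_ : ∀ {a b c d : ℚ} → a ≡ c → b ≡ d → (a +i b) ≡ (c +i d)
  refl +i-cong refl = refl

⊕-assoc : ∀ x y z → (x ⊕ y) ⊕ z ≡ x ⊕ (y ⊕ z)
⊕-assoc (a +i b) (c +i d) (e +i g) = ℚₚ.+-assoc a c e +i-cong ℚₚ.+-assoc b d g

⊕-comm : ∀ x y → x ⊕ y ≡ y ⊕ x
⊕-comm (a +i b) (c +i d) = ℚₚ.+-comm a c +i-cong ℚₚ.+-comm b d

⊕-identityˡ : ∀ x → 𝟘 ⊕ x ≡ x
⊕-identityˡ (a +i b) = ℚₚ.+-identityˡ a +i-cong ℚₚ.+-identityˡ b

⊝-inverseˡ : ∀ x → (⊝ x) ⊕ x ≡ 𝟘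
⊝-inverseˡ (a +i b) = ℚₚ.+-inverseˡ a +i-cong ℚₚ.+-inverseˡ b

module _ where
  open +-*-Solver

  ⊗-assoc : ∀ x y z → (x ⊗ y) ⊗ z ≡ x ⊗ (y ⊗ z)
  ⊗-assoc (a +i b) (c +i d) (e +i g) =
    solve 6 (λ a b c d e g → ((a :* c) :- (b :* d)) :* e :- ((a :* d) :+ (b :* c)) :* g
                          := a :* ((c :* e) :- (d :* g)) :- b :* ((c :* g) :+ (d :* e))) refl a b c d e g
    +i-cong
    solve 6 (λ a b c d e g → ((a :* c) :- (b :* d)) :* g :+ ((a :* d) :+ (b :* c)) :* e
                          := a :* ((c :* g) :+ (d :* e)) :+ b :* ((c :* e) :- (d :* g))) refl a b c d e g

  ⊗-comm : ∀ x y → x ⊗ y ≡ y ⊗ x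
  ⊗-comm (a +i b) (c +i d) =
    solve 4 (λ a b c d → (a :* c) :- (b :* d) := (c :* a) :- (d :* b)) refl a b c d
    +i-cong
    solve 4 (λ a b c d → (a :* d) :+ (b :* c) := (c :* b) :+ (d :* a)) refl a b c d

  ⊗-identityˡ : ∀ x → 𝟙 ⊗ x ≡ x
  ⊗-identityˡ (a +i b) =
    solve 2 (λ a b → (con 1ℚ :* a) :- (con 0ℚ :* b) := a) refl a b
    +i-cong
    solve 2 (λ a b → (con 1ℚ :* b) :+ (con 0ℚ :* a) := b) refl a b

  ⊗-distribˡ-⊕ : ∀ x y z → x ⊗ (y ⊕ z) ≡ (x ⊗ y) ⊕ (x ⊗ z)
  ⊗-distribˡ-⊕ (a +i b) (c +i d) (e +i g) =
    solve 6 (λ a b c d e g → (a :* (c :+ e)) :- (b :* (d :+ g))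
                          := ((a :* c) :- (b :* d)) :+ ((a :* e) :- (b :* g))) refl a b c d e g
    +i-cong
    solve 6 (λ a b c d e g → (a :* (d :+ g)) :+ (b :* (c :+ e))
                          := ((a :* d) :+ (b :* c)) :+ ((a :* g) :+ (b :* e))) refl a b c d e g

isCommutativeRing : IsCommutativeRing _⊕_ _⊗_ ⊝_ 𝟘 𝟙
isCommutativeRing = record
  { isRing = record
    { +-isAbelianGroup = record
      { isGroup = record
        { isMonoid = record
          { isSemigroup = record
            { isMagma = record { isEquivalence = isEquivalence ; ∙-cong = cong₂ _⊕_ }
            ; assoc = ⊕-assoc }
          ; identity = comm∧idˡ⇒id ⊕-comm ⊕-identityˡ }
        ; inverse = comm∧invˡ⇒inv ⊕-comm ⊝-inverseˡ
        ; ⁻¹-cong = cong ⊝_ }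
      ; comm = ⊕-comm }
    ; *-cong = cong₂ _⊗_
    ; *-assoc = ⊗-assoc
    ; *-identity = comm∧idˡ⇒id ⊗-comm ⊗-identityˡ
    ; distrib = ⊗-distribˡ-⊕ , comm∧distrˡ⇒distrʳ ⊗-comm ⊗-distribˡ-⊕ }
  ; *-comm = ⊗-comm }

commutativeRing : CommutativeRing 0ℓ 0ℓ
commutativeRing = record { isCommutativeRing = isCommutativeRing }

open CommutativeRing commutativeRing using (*-commutativeMonoid)
  renaming (+-identityʳ to ⊕-identityʳ; zeroˡ to ⊗-zeroˡ; zeroʳ to ⊗-zeroʳ)

fromℕ-suc : ∀ k → fromℕ (suc k) ≡ 𝟙 ⊕ fromℕ k
fromℕ-suc k = cong (_+i 0ℚ) (begin
  + suc k ℚ./ 1        ≡⟨ ℚₚ./-cong {p₂ = (+ 1) ℤ.* (+ 1) ℤ.+ (+ k) ℤ.* (+ 1)} {q₂ = 1}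
                            (cong (ℤ._+_ (+ 1)) (sym (ℤₚ.*-identityʳ (+ k)))) refl ⟩
  1ℚ ℚ.+ k/1           ≡⟨ cong (1ℚ ℚ.+_) (sym (ℚₚ.↥p/↧p≡p k/1)) ⟩
  1ℚ ℚ.+ (+ k ℚ./ 1)   ∎)
  where
  open ≡-Reasoning
  k/1 : ℚ
  k/1 = mkℚ (+ k) 0 (Coprime.sym (1-coprimeTo k))

fromℕ-+ : ∀ m k → fromℕ (m + k) ≡ fromℕ m ⊕ fromℕ k
fromℕ-+ zero    k = sym (⊕-identityˡ (fromℕ k))
fromℕ-+ (suc m) k = begin
  fromℕ (suc (m + k))          ≡⟨ fromℕ-suc (m + k) ⟩
  𝟙 ⊕ fromℕ (m + k)            ≡⟨ cong (𝟙 ⊕_) (fromℕ-+ m k) ⟩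
  𝟙 ⊕ (fromℕ m ⊕ fromℕ k)      ≡⟨ sym (⊕-assoc 𝟙 (fromℕ m) (fromℕ k)) ⟩
  (𝟙 ⊕ fromℕ m) ⊕ fromℕ k      ≡⟨ cong (_⊕ fromℕ k) (sym (fromℕ-suc m)) ⟩
  fromℕ (suc m) ⊕ fromℕ k      ∎
  where open ≡-Reasoning

private
  positive⇒≢0 : ∀ p → Positive p → p ≢ 0ℚ
  positive⇒≢0 p p>0 refl = ℚₚ.<-irrefl refl (ℚₚ.positive⁻¹ 0ℚ {{p>0}})

  square-positive : ∀ a → a ≢ 0ℚ → Positive (a ℚ.* a)
  square-positive a@(mkℚ ℤ.+[1+ _ ] _ _) _ = ℚₚ.pos*pos⇒pos a a
  square-positive a@(mkℚ -[1+ _ ] _ _)   _ = ℚₚ.neg*neg⇒pos a a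
  square-positive (mkℚ (+ 0) _ _) a≢0 with ℚ.≢-nonZero a≢0
  ... | ()

  square-nonNegative : ∀ a → NonNegative (a ℚ.* a)
  square-nonNegative a with a ℚₚ.≟ 0ℚ
  ... | yes refl = _
  ... | no a≢0   = ℚₚ.pos⇒nonNeg (a ℚ.* a) {{square-positive a a≢0}}

  normSq≢0 : ∀ a b → (a +i b) ≢ 𝟘 → a ℚ.* a ℚ.+ b ℚ.* b ≢ 0ℚ
  normSq≢0 a b z≢0 with a ℚₚ.≟ 0ℚ | b ℚₚ.≟ 0ℚ
  ... | yes refl | yes refl = λ _ → z≢0 refl
  ... | no a≢0   | _        = positive⇒≢0 _ (ℚₚ.pos+nonNeg⇒pos (a ℚ.* a)
                                {{square-positive a a≢0}} (b ℚ.* b) {{square-nonNegative b}})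
  ... | yes _    | no b≢0   = positive⇒≢0 _ (ℚₚ.nonNeg+pos⇒pos (a ℚ.* a)
                                {{square-nonNegative a}} (b ℚ.* b) {{square-positive b b≢0}})

  invℚ-inverseˡ : ∀ p → p ≢ 0ℚ → invℚ p ℚ.* p ≡ 1ℚ
  invℚ-inverseˡ p p≢0 with p ℚₚ.≟ 0ℚ
  ... | yes p≡0 = ⊥-elim (p≢0 p≡0)
  ... | no p≢0′ = ℚₚ.*-inverseˡ p {{ℚ.≢-nonZero p≢0′}}

inv-inverseˡ : ∀ x → x ≢ 𝟘 → inv x ⊗ x ≡ 𝟙
inv-inverseˡ (a +i b) x≢0 = re-part +i-cong im-part
  where
  open +-*-Solver
  m : ℚ
  m = invℚ (a ℚ.* a ℚ.+ b ℚ.* b)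
  re-part : (a ℚ.* m) ℚ.* a ℚ.- ((ℚ.- b) ℚ.* m) ℚ.* b ≡ 1ℚ
  re-part = trans (solve 3 (λ a b m → ((a :* m) :* a) :- (((:- b) :* m) :* b)
                                   := m :* ((a :* a) :+ (b :* b))) refl a b m)
                  (invℚ-inverseˡ _ (normSq≢0 a b x≢0))
  im-part : (a ℚ.* m) ℚ.* b ℚ.+ ((ℚ.- b) ℚ.* m) ℚ.* a ≡ 0ℚ
  im-part = solve 3 (λ a b m → ((a :* m) :* b) :+ (((:- b) :* m) :* a) := con 0ℚ) refl a b m

_≟_ : (x y : GQ) → Dec (x ≡ y)
(a +i b) ≟ (c +i d) with a ℚₚ.≟ c | b ℚₚ.≟ d
... | yes refl | yes refl = yes refl
... | no a≢c   | _        = no λ { refl → a≢c refl }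
... | yes _    | no b≢d   = no λ { refl → b≢d refl }

module GQ-Solver = RingSolver (ACR.fromCommutativeRing commutativeRing) _≟_
open GQ-Solver using (solve; _:=_; _:+_; _:*_; :-_; _:-_; con)

^-homo-⊗ : ∀ x m k → x ^ (m + k) ≡ x ^ m ⊗ x ^ k
^-homo-⊗ x zero    k = sym (⊗-identityˡ (x ^ k))
^-homo-⊗ x (suc m) k = trans (cong (x ⊗_) (^-homo-⊗ x m k)) (sym (⊗-assoc x (x ^ m) (x ^ k)))

^-distrib-⊗ : ∀ x y k → (x ⊗ y) ^ k ≡ x ^ k ⊗ y ^ k
^-distrib-⊗ x y zero    = refl
^-distrib-⊗ x y (suc k) = trans (cong ((x ⊗ y) ⊗_) (^-distrib-⊗ x y k))
  (solve 4 (λ x y X Y → (x :* y) :* (X :* Y) := (x :* X) :* (y :* Y)) refl x y (x ^ k) (y ^ k))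

𝟙^≡𝟙 : ∀ k → 𝟙 ^ k ≡ 𝟙
𝟙^≡𝟙 zero    = refl
𝟙^≡𝟙 (suc k) = trans (⊗-identityˡ (𝟙 ^ k)) (𝟙^≡𝟙 k)

^-double : ∀ u k → u ^ (2 ℕ.* k) ≡ (u ⊗ u) ^ k
^-double u k = begin
  u ^ (k + (k + 0))    ≡⟨ ^-homo-⊗ u k (k + 0) ⟩
  u ^ k ⊗ u ^ (k + 0)  ≡⟨ cong (λ m → u ^ k ⊗ u ^ m) (ℕₚ.+-identityʳ k) ⟩
  u ^ k ⊗ u ^ k        ≡⟨ sym (^-distrib-⊗ u u k) ⟩
  (u ⊗ u) ^ k          ∎
  where open ≡-Reasoning

module _ {x : GQ} (x≢0 : x ≢ 𝟘) where

  ^-inverseˡ : ∀ k → inv x ^ k ⊗ x ^ k ≡ 𝟙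
  ^-inverseˡ k = begin
    inv x ^ k ⊗ x ^ k   ≡⟨ sym (^-distrib-⊗ (inv x) x k) ⟩
    (inv x ⊗ x) ^ k     ≡⟨ cong (_^ k) (inv-inverseˡ x x≢0) ⟩
    𝟙 ^ k               ≡⟨ 𝟙^≡𝟙 k ⟩
    𝟙                   ∎
    where open ≡-Reasoning

  ^-cancelˡ : ∀ k {X Y} → x ^ k ⊗ X ≡ x ^ k ⊗ Y → X ≡ Y
  ^-cancelˡ k {X} {Y} eq = begin
    X                          ≡⟨ sym (unit X) ⟩
    (inv x ^ k ⊗ x ^ k) ⊗ X    ≡⟨ ⊗-assoc (inv x ^ k) (x ^ k) X ⟩
    inv x ^ k ⊗ (x ^ k ⊗ X)    ≡⟨ cong (inv x ^ k ⊗_) eq ⟩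
    inv x ^ k ⊗ (x ^ k ⊗ Y)    ≡⟨ sym (⊗-assoc (inv x ^ k) (x ^ k) Y) ⟩
    (inv x ^ k ⊗ x ^ k) ⊗ Y    ≡⟨ unit Y ⟩
    Y                          ∎
    where
    open ≡-Reasoning
    unit : ∀ Z → (inv x ^ k ⊗ x ^ k) ⊗ Z ≡ Z
    unit Z = trans (cong (_⊗ Z) (^-inverseˡ k)) (⊗-identityˡ Z)

  ^[m+d]⊗inv^d≡^m : ∀ m d → x ^ (m + d) ⊗ inv x ^ d ≡ x ^ m
  ^[m+d]⊗inv^d≡^m m d = begin
    x ^ (m + d) ⊗ inv x ^ d          ≡⟨ cong (_⊗ inv x ^ d) (^-homo-⊗ x m d) ⟩
    (x ^ m ⊗ x ^ d) ⊗ inv x ^ d      ≡⟨ solve 3 (λ X D I → (X :* D) :* I := X :* (I :* D)) refl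
                                           (x ^ m) (x ^ d) (inv x ^ d) ⟩
    x ^ m ⊗ (inv x ^ d ⊗ x ^ d)      ≡⟨ cong (x ^ m ⊗_) (^-inverseˡ d) ⟩
    x ^ m ⊗ 𝟙                        ≡⟨ solve 1 (λ X → X :* con 𝟙 := X) refl (x ^ m) ⟩
    x ^ m                            ∎
    where open ≡-Reasoning

  ^k⊗^ℤ[m-k]≡^m : ∀ m k → x ^ k ⊗ x ^ℤ (+ m ℤ.- + k) ≡ x ^ m
  ^k⊗^ℤ[m-k]≡^m m k rewrite ℤₚ.[+m]-[+n]≡m⊖n m k with ℕₚ.≤-total k m
  ... | inj₁ k≤m rewrite ℤₚ.⊖-≥ k≤m =
    trans (sym (^-homo-⊗ x k (m ∸ k))) (cong (x ^_) (ℕₚ.m+[n∸m]≡n k≤m))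
  ... | inj₂ m≤k rewrite ℤₚ.⊖-≤ m≤k with k ∸ m | ℕₚ.m+[n∸m]≡n m≤k
  ...   | d | refl = trans (cong (x ^ (m + d) ⊗_) (^ℤ-neg d)) (^[m+d]⊗inv^d≡^m m d)
    where
    ^ℤ-neg : ∀ d → x ^ℤ (ℤ.- (+ d)) ≡ inv x ^ d
    ^ℤ-neg zero    = refl
    ^ℤ-neg (suc d) = refl

  ^m⊗X≡^k⊗Y⇒X⊗^ℤ[m-k]≡Y : ∀ m k {X Y} → x ^ m ⊗ X ≡ x ^ k ⊗ Y → X ⊗ x ^ℤ (+ m ℤ.- + k) ≡ Y
  ^m⊗X≡^k⊗Y⇒X⊗^ℤ[m-k]≡Y m k {X} {Y} eq = ^-cancelˡ k (begin
    x ^ k ⊗ (X ⊗ D)    ≡⟨ solve 3 (λ P X D → P :* (X :* D) := X :* (P :* D)) refl (x ^ k) X D ⟩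
    X ⊗ (x ^ k ⊗ D)    ≡⟨ cong (X ⊗_) (^k⊗^ℤ[m-k]≡^m m k) ⟩
    X ⊗ x ^ m          ≡⟨ ⊗-comm X (x ^ m) ⟩
    x ^ m ⊗ X          ≡⟨ eq ⟩
    x ^ k ⊗ Y          ∎)
    where
    open ≡-Reasoning
    D : GQ
    D = x ^ℤ (+ m ℤ.- + k)

𝟙⊖≢𝟘 : ∀ {β} → β ≢ 𝟙 → 𝟙 ⊖ β ≢ 𝟘
𝟙⊖≢𝟘 {β} β≢1 1-β≡0 = β≢1 (begin
  β              ≡⟨ solve 1 (λ β → β := con 𝟙 :- (con 𝟙 :- β)) refl β ⟩
  𝟙 ⊖ (𝟙 ⊖ β)    ≡⟨ cong (𝟙 ⊖_) 1-β≡0 ⟩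
  𝟙 ⊖ 𝟘          ≡⟨⟩
  𝟙              ∎)
  where open ≡-Reasoning

-- Finite sums and products

foldr-map-allFin : ∀ {A B : Set} (_∙_ : A → B → B) e {n} (h : Fin n → A) →
  List.foldr _∙_ e (List.map h (allFin n)) ≡ Vector.foldr _∙_ e h
foldr-map-allFin _∙_ e h = trans (cong (List.foldr _∙_ e) (map-tabulate id h)) (foldr-tabulate h)
  where
  foldr-tabulate : ∀ {n} h → List.foldr _∙_ e (List.tabulate {n = n} h) ≡ Vector.foldr _∙_ e h
  foldr-tabulate {zero}  h = refl
  foldr-tabulate {suc n} h = cong (h zero ∙_) (foldr-tabulate (h ∘ suc))

offEdge : ∀ {a} {A : Set a} {n} → Edge n → A → (Fin n → A) → Fin n → A
offEdge e ε t v = if incident v e then ε else t v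

module EdgeSum {c ℓ} (M : CommutativeMonoid c ℓ) where
  open CommutativeMonoid M
    using (Carrier; _≈_; _∙_; ε; ∙-congˡ; identityˡ; setoid; commutativeSemigroup)
    renaming (sym to ≈-sym)
  open import Algebra.Properties.CommutativeMonoid.Sum M using (sum; sum-cong-≗)
  open import Algebra.Properties.CommutativeSemigroup commutativeSemigroup using (x∙yz≈y∙xz)
  open import Relation.Binary.Reasoning.Setoid setoid

  sum-pick : ∀ {n} (t : Fin n → Carrier) i →
    sum t ≈ t i ∙ sum (λ v → if does (v ≟F i) then ε else t v)
  sum-pick t zero    = ∙-congˡ (≈-sym (identityˡ (sum (t ∘ suc))))
  sum-pick t (suc i) = begin
    t zero ∙ sum (t ∘ suc)                    ≈⟨ ∙-congˡ (sum-pick (t ∘ suc) i) ⟩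
    t zero ∙ (t (suc i) ∙ sum (mask ∘ suc))   ≈⟨ x∙yz≈y∙xz (t zero) (t (suc i)) (sum (mask ∘ suc)) ⟩
    t (suc i) ∙ (t zero ∙ sum (mask ∘ suc))   ∎
    where
    mask : Fin _ → Carrier
    mask v = if does (v ≟F suc i) then ε else t v

  sum-edge : ∀ {n} {a b : Fin n} {t r : Fin n → Carrier} → a ≢ b →
    (∀ v → incident v (a , b) ≡ false → t v ≡ r v) →
    ∀ {x y} → t a ≡ x → t b ≡ y → sum t ≈ x ∙ (y ∙ sum (offEdge (a , b) ε r))
  sum-edge {a = a} {b} {t} {r} a≢b t≗r {x} {y} ta≡x tb≡y = begin
    sum t                                  ≈⟨ sum-pick t a ⟩
    t a ∙ sum tₐ                           ≈⟨ ∙-congˡ (sum-pick tₐ b) ⟩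
    t a ∙ (tₐ b ∙ sum (mask b tₐ))         ≡⟨ cong₂ (λ p q → p ∙ (q ∙ sum (mask b tₐ))) ta≡x
                                                     (trans tₐb≡tb tb≡y) ⟩
    x ∙ (y ∙ sum (mask b tₐ))              ≡⟨ cong (λ p → x ∙ (y ∙ p)) (sum-cong-≗ masks) ⟩
    x ∙ (y ∙ sum (offEdge (a , b) ε r))    ∎
    where
    mask : Fin _ → (Fin _ → Carrier) → Fin _ → Carrier
    mask i u v = if does (v ≟F i) then ε else u v
    tₐ : Fin _ → Carrier
    tₐ = mask a t
    tₐb≡tb : tₐ b ≡ t b
    tₐb≡tb with b ≟F a
    ... | yes b≡a = ⊥-elim (a≢b (sym b≡a))
    ... | no _    = refl
    masks : ∀ v → mask b tₐ v ≡ offEdge (a , b) ε r v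
    masks v with does (v ≟F a) | does (v ≟F b) | t≗r v
    ... | true  | true  | _   = refl
    ... | true  | false | _   = refl
    ... | false | true  | _   = refl
    ... | false | false | t≡r = t≡r refl

open import Algebra.Properties.CommutativeMonoid.Sum *-commutativeMonoid
  using () renaming (sum to ∏; sum-cong-≗ to ∏-cong; ∑-distrib-+ to ∏-distrib-⊗)
open import Algebra.Properties.CommutativeMonoid.Sum ℕₚ.+-0-commutativeMonoid
  using ()
  renaming (sum to Σ; sum-cong-≗ to Σ-cong; ∑-distrib-+ to Σ-distrib-+; sum-replicate-zero to Σ-zeros)
open EdgeSum *-commutativeMonoid using () renaming (sum-edge to ∏-edge)
open EdgeSum ℕₚ.+-0-commutativeMonoid using () renaming (sum-edge to Σ-edge)

∏-const : ∀ n x → ∏ {n} (λ _ → x) ≡ x ^ n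
∏-const zero    x = refl
∏-const (suc n) x = cong (x ⊗_) (∏-const n x)

∏-^ : ∀ {n} x (m : Fin n → ℕ) → ∏ (λ v → x ^ m v) ≡ x ^ Σ m
∏-^ {zero}  x m = refl
∏-^ {suc n} x m = trans (cong (x ^ m zero ⊗_) (∏-^ x (m ∘ suc)))
                        (sym (^-homo-⊗ x (m zero) (Σ (m ∘ suc))))

sumGQ-++ : ∀ xs ys → sumGQ (xs ++ ys) ≡ sumGQ xs ⊕ sumGQ ys
sumGQ-++ []       ys = sym (⊕-identityˡ (sumGQ ys))
sumGQ-++ (x ∷ xs) ys = trans (cong (x ⊕_) (sumGQ-++ xs ys)) (sym (⊕-assoc x (sumGQ xs) (sumGQ ys)))

sumGQ-map-⊕ : ∀ {A : Set} (F G : A → GQ) xs →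
  sumGQ (List.map (λ a → F a ⊕ G a) xs) ≡ sumGQ (List.map F xs) ⊕ sumGQ (List.map G xs)
sumGQ-map-⊕ F G []       = sym (⊕-identityˡ 𝟘)
sumGQ-map-⊕ F G (a ∷ xs) = trans (cong (F a ⊕ G a ⊕_) (sumGQ-map-⊕ F G xs))
  (solve 4 (λ a b c d → (a :+ b) :+ (c :+ d) := (a :+ c) :+ (b :+ d)) refl
     (F a) (G a) (sumGQ (List.map F xs)) (sumGQ (List.map G xs)))

sumGQ-map-⊗ˡ : ∀ {A : Set} k (F : A → GQ) xs →
  sumGQ (List.map (λ a → k ⊗ F a) xs) ≡ k ⊗ sumGQ (List.map F xs)
sumGQ-map-⊗ˡ k F []       = sym (⊗-zeroʳ k)
sumGQ-map-⊗ˡ k F (a ∷ xs) = trans (cong (k ⊗ F a ⊕_) (sumGQ-map-⊗ˡ k F xs))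
                                  (sym (⊗-distribˡ-⊕ k (F a) (sumGQ (List.map F xs))))

sumGQ-map-𝟘 : ∀ {A : Set} (xs : List A) → sumGQ (List.map (λ _ → 𝟘) xs) ≡ 𝟘
sumGQ-map-𝟘 []       = refl
sumGQ-map-𝟘 (_ ∷ xs) = trans (cong (𝟘 ⊕_) (sumGQ-map-𝟘 xs)) (⊕-identityˡ 𝟘)

sumGQ-subsets-∷ : ∀ {A : Set} (F : List A → GQ) x xs →
  sumGQ (List.map F (subsets (x ∷ xs))) ≡ sumGQ (List.map (λ s → F s ⊕ F (x ∷ s)) (subsets xs))
sumGQ-subsets-∷ F x xs = begin
  sumGQ (List.map F (ss ++ List.map (x ∷_) ss))
    ≡⟨ cong sumGQ (map-++ F ss (List.map (x ∷_) ss)) ⟩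
  sumGQ (List.map F ss ++ List.map F (List.map (x ∷_) ss))
    ≡⟨ sumGQ-++ (List.map F ss) (List.map F (List.map (x ∷_) ss)) ⟩
  sumGQ (List.map F ss) ⊕ sumGQ (List.map F (List.map (x ∷_) ss))
    ≡⟨ cong (λ l → sumGQ (List.map F ss) ⊕ sumGQ l) (sym (map-∘ ss)) ⟩
  sumGQ (List.map F ss) ⊕ sumGQ (List.map (λ s → F (x ∷ s)) ss)
    ≡⟨ sym (sumGQ-map-⊕ F (λ s → F (x ∷ s)) ss) ⟩
  sumGQ (List.map (λ s → F s ⊕ F (x ∷ s)) ss)  ∎
  where
  open ≡-Reasoning
  ss = subsets xs

sumGQ-indicator : ∀ {j N} (F : ℕ → GQ) → j < N →
  sumGQ (applyUpTo (λ k → if j ℕ.≡ᵇ k then F k else 𝟘) N) ≡ F j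
sumGQ-indicator {zero}  {suc N} F _ = trans (cong (F 0 ⊕_) zeros) (⊕-identityʳ (F 0))
  where
  zeros : sumGQ (applyUpTo (λ _ → 𝟘) N) ≡ 𝟘
  zeros = trans (cong sumGQ (sym (map-upTo (λ _ → 𝟘) N))) (sumGQ-map-𝟘 (upTo N))
sumGQ-indicator {suc j} {suc N} F (s≤s j<N) =
  trans (⊕-identityˡ _) (sumGQ-indicator (F ∘ suc) j<N)

module _ {A : Set} (P : A → Bool) (κ : A → ℕ) (F : ℕ → GQ) {N : ℕ} where

  fibreSize : List A → ℕ → ℕ
  fibreSize L k = List.length (List.filter (λ x → (P x ∧ (κ x ℕ.≡ᵇ k)) Bool.≟ true) L)

  sumGQ-fibres : ∀ L → All (λ x → P x ≡ true → κ x < N) L →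
    sumGQ (List.map (λ x → if P x then F (κ x) else 𝟘) L)
    ≡ sumGQ (List.map (λ k → fromℕ (fibreSize L k) ⊗ F k) (upTo N))
  sumGQ-fibres [] [] =
    sym (trans (cong sumGQ (map-cong (λ k → ⊗-zeroˡ (F k)) (upTo N))) (sumGQ-map-𝟘 (upTo N)))
  sumGQ-fibres (x ∷ L) (bounded ∷ bounds) = begin
    (if P x then F (κ x) else 𝟘) ⊕ sumGQ (List.map (λ x → if P x then F (κ x) else 𝟘) L)
      ≡⟨ cong₂ _⊕_ (sym (head bounded)) (sumGQ-fibres L bounds) ⟩
    sumGQ (List.map δₓ (upTo N)) ⊕ sumGQ (List.map (λ k → fromℕ (fibreSize L k) ⊗ F k) (upTo N))
      ≡⟨ sym (sumGQ-map-⊕ δₓ (λ k → fromℕ (fibreSize L k) ⊗ F k) (upTo N)) ⟩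
    sumGQ (List.map (λ k → δₓ k ⊕ fromℕ (fibreSize L k) ⊗ F k) (upTo N))
      ≡⟨ cong sumGQ (map-cong (λ k → sym (fibreSize-∷ k)) (upTo N)) ⟩
    sumGQ (List.map (λ k → fromℕ (fibreSize (x ∷ L) k) ⊗ F k) (upTo N))  ∎
    where
    open ≡-Reasoning
    δₓ : ℕ → GQ
    δₓ k = if P x ∧ (κ x ℕ.≡ᵇ k) then F k else 𝟘
    head : (P x ≡ true → κ x < N) → sumGQ (List.map δₓ (upTo N)) ≡ (if P x then F (κ x) else 𝟘)
    head κx<N with P x
    ... | true  = trans (cong sumGQ (map-upTo (λ k → if κ x ℕ.≡ᵇ k then F k else 𝟘) N))
                        (sumGQ-indicator F (κx<N refl))
    ... | false = sumGQ-map-𝟘 (upTo N)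
    fibreSize-∷ : ∀ k → fromℕ (fibreSize (x ∷ L) k) ⊗ F k ≡ δₓ k ⊕ fromℕ (fibreSize L k) ⊗ F k
    fibreSize-∷ k with P x ∧ (κ x ℕ.≡ᵇ k)
    ... | true  = trans (cong (_⊗ F k) (fromℕ-suc (fibreSize L k)))
                        (solve 2 (λ C F → (con 𝟙 :+ C) :* F := F :+ C :* F) refl (fromℕ (fibreSize L k)) (F k))
    ... | false = sym (⊕-identityˡ (fromℕ (fibreSize L k) ⊗ F k))

-- Degrees and matchings

incidence : ∀ {n} → Edge n → Fin n → ℕ
incidence e v = if incident v e then 1 else 0

incidence-fst : ∀ {n} (a b : Fin n) → incidence (a , b) a ≡ 1
incidence-fst a b with a ≟F a
... | yes _   = refl
... | no a≢a = ⊥-elim (a≢a refl)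

incidence-snd : ∀ {n} (a b : Fin n) → incidence (a , b) b ≡ 1
incidence-snd a b with b ≟F a | b ≟F b
... | yes _ | _       = refl
... | no _  | yes _   = refl
... | no _  | no b≢b = ⊥-elim (b≢b refl)

incidence-off : ∀ {n} (e : Edge n) {v} → incident v e ≡ false → incidence e v ≡ 0
incidence-off e off = cong (if_then 1 else 0) off

deg-∷ : ∀ {n} (e : Edge n) s v → deg (e ∷ s) v ≡ incidence e v + deg s v
deg-∷ e s v with incident v e
... | true  = refl
... | false = refl

deg-∷-end : ∀ {n} (e : Edge n) s {v} → incidence e v ≡ 1 → deg (e ∷ s) v ≡ suc (deg s v)
deg-∷-end e s {v} end = trans (deg-∷ e s v) (cong (_+ deg s v) end)

deg-∷-off : ∀ {n} (e : Edge n) s {v} → incident v e ≡ false → deg (e ∷ s) v ≡ deg s v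
deg-∷-off e s {v} off = trans (deg-∷ e s v) (cong (_+ deg s v) (incidence-off e {v} off))

Proper : ∀ {n} → Edge n → Set
Proper (a , b) = a ≢ b

Σ-incidence : ∀ {n} {a b : Fin n} → a ≢ b → Σ (incidence (a , b)) ≡ 2
Σ-incidence {n} {a} {b} a≢b = begin
  Σ (incidence e)
    ≡⟨ Σ-edge a≢b (λ v → incidence-off e {v}) (incidence-fst a b) (incidence-snd a b) ⟩
  1 + (1 + Σ (offEdge e 0 (λ _ → 0)))
    ≡⟨ cong (λ k → 2 + k) (trans (Σ-cong (λ v → if-eta (incident v e))) (Σ-zeros n)) ⟩
  2  ∎
  where
  open ≡-Reasoning
  e = (a , b)

handshake : ∀ {n} (s : List (Edge n)) → All Proper s → Σ (deg s) ≡ 2 ℕ.* List.length s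
handshake {n} []              []             = Σ-zeros n
handshake {n} (e@(a , b) ∷ s) (a≢b ∷ proper) = begin
  Σ (deg (e ∷ s))                          ≡⟨ Σ-cong (deg-∷ e s) ⟩
  Σ (λ v → incidence e v + deg s v)        ≡⟨ Σ-distrib-+ (incidence e) (deg s) ⟩
  Σ (incidence e) + Σ (deg s)              ≡⟨ cong₂ _+_ (Σ-incidence a≢b) (handshake s proper) ⟩
  2 + 2 ℕ.* List.length s                  ≡⟨ sym (ℕₚ.*-suc 2 (List.length s)) ⟩
  2 ℕ.* suc (List.length s)                ∎
  where open ≡-Reasoning

edges-proper : ∀ {n} (G : SimpleGraph n) → All Proper (edges G)
edges-proper {n} G =
  concat⁺ (map⁺ (All.universal (λ i → concat⁺ (map⁺ (All.universal (candidate i) (allFin n)))) (allFin n)))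
  where
  candidate : ∀ i j → All Proper (if adj G i j ∧ (toℕ i ℕ.<ᵇ toℕ j) then (i , j) ∷ [] else [])
  candidate i j with adj G i j in adjᵢⱼ | toℕ i ℕ.<ᵇ toℕ j
  ... | false | _     = []
  ... | true  | false = []
  ... | true  | true  = i≢j ∷ []
    where
    i≢j : i ≢ j
    i≢j refl with trans (sym adjᵢⱼ) (adj-irr G i)
    ... | ()

subsets⁺ : ∀ {A : Set} {P : A → Set} {xs} → All P xs → All (All P) (subsets xs)
subsets⁺ []         = [] ∷ []
subsets⁺ (px ∷ pxs) = ++⁺ (subsets⁺ pxs) (map⁺ (All.map (px ∷_) (subsets⁺ pxs)))

atMostOne : ∀ {n} → (Fin n → ℕ) → Bool
atMostOne d = Vector.foldr _∧_ true (λ v → d v ℕ.≤ᵇ 1)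

IsMatching≡atMostOne : ∀ {n} (s : List (Edge n)) → IsMatching s ≡ atMostOne (deg s)
IsMatching≡atMostOne s = foldr-map-allFin _∧_ true (λ v → deg s v ℕ.≤ᵇ 1)

atMostOne-complement : ∀ {n} (d : Fin n → ℕ) → atMostOne d ≡ true → Σ (λ v → 1 ∸ d v) + Σ d ≡ n
atMostOne-complement {zero}  d _ = refl
atMostOne-complement {suc n} d ok with d zero | atMostOne (d ∘ suc) | atMostOne-complement (d ∘ suc)
... | zero     | true | ih = cong suc (ih refl)
... | suc zero | true | ih = trans (ℕₚ.+-suc _ _) (cong suc (ih refl))

matching-size : ∀ {n} (s : List (Edge n)) → All Proper s → IsMatching s ≡ true → List.length s ≤ ⌊ n /2⌋
matching-size {n} s proper matching = begin
  k                ≡⟨ ℕₚ.n≡⌊n+n/2⌋ k ⟩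
  ⌊ k + k /2⌋      ≤⟨ ℕₚ.⌊n/2⌋-mono (begin
    k + k                              ≡⟨ cong (_+_ k) (sym (ℕₚ.+-identityʳ k)) ⟩
    2 ℕ.* k                            ≡⟨ sym (handshake s proper) ⟩
    Σ (deg s)                          ≤⟨ ℕₚ.m≤n+m (Σ (deg s)) _ ⟩
    Σ (λ v → 1 ∸ deg s v) + Σ (deg s)  ≡⟨ atMostOne-complement (deg s)
                                              (trans (sym (IsMatching≡atMostOne s)) matching) ⟩
    n                                  ∎) ⟩
  ⌊ n /2⌋          ∎
  where
  open ℕₚ.≤-Reasoning
  k : ℕ
  k = List.length s

double-≤ : ∀ {k n} → k ≤ ⌊ n /2⌋ → 2 ℕ.* k ≤ n
double-≤ {k} {n} k≤n/2 = begin
  k + (k + 0)          ≡⟨ cong (_+_ k) (ℕₚ.+-identityʳ k) ⟩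
  k + k                ≤⟨ ℕₚ.+-mono-≤ k≤n/2 (ℕₚ.≤-trans k≤n/2 (ℕₚ.⌊n/2⌋≤⌈n/2⌉ n)) ⟩
  ⌊ n /2⌋ + ⌈ n /2⌉    ≡⟨ ℕₚ.⌊n/2⌋+⌈n/2⌉≡n n ⟩
  n                    ∎
  where open ℕₚ.≤-Reasoning

μ-weight : ℕ → GQ → GQ
μ-weight zero          X = X
μ-weight (suc zero)    _ = 𝟙
μ-weight (suc (suc _)) _ = 𝟘

∏-μ-weight : ∀ {n} (d : Fin n → ℕ) X →
  ∏ (λ v → μ-weight (d v) X) ≡ (if atMostOne d then X ^ Σ (λ v → 1 ∸ d v) else 𝟘)
∏-μ-weight {zero}  d X = refl
∏-μ-weight {suc n} d X with d zero | atMostOne (d ∘ suc) | ∏-μ-weight (d ∘ suc) X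
... | zero        | true  | ih = cong (X ⊗_) ih
... | zero        | false | ih = trans (cong (X ⊗_) ih) (⊗-zeroʳ X)
... | suc zero    | _     | ih = trans (⊗-identityˡ (∏ (λ v → μ-weight (d (suc v)) X))) ih
... | suc (suc _) | _     | _  = ⊗-zeroˡ (∏ (λ v → μ-weight (d (suc v)) X))

∏-μ-weight-deg : ∀ {n} (s : List (Edge n)) → All Proper s → ∀ X →
  ∏ (λ v → μ-weight (deg s v) X) ≡ (if IsMatching s then X ^ (n ∸ 2 ℕ.* List.length s) else 𝟘)
∏-μ-weight-deg {n} s proper X rewrite IsMatching≡atMostOne s
  with atMostOne (deg s) in matching | ∏-μ-weight (deg s) X
... | false | eq = eq
... | true  | eq = trans eq (cong (X ^_) (begin
  Σ (λ v → 1 ∸ deg s v)                          ≡⟨ sym (ℕₚ.m+n∸n≡m _ (Σ (deg s))) ⟩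
  Σ (λ v → 1 ∸ deg s v) + Σ (deg s) ∸ Σ (deg s)  ≡⟨ cong₂ _∸_ (atMostOne-complement (deg s) matching)
                                                              (handshake s proper) ⟩
  n ∸ 2 ℕ.* List.length s                        ∎))
  where open ≡-Reasoning

-- Charged θ-sums

-- f_d(2i) = i^d (1 - d), with the constant 1 generalised to a charge c.
θ-weight : GQ → ℕ → GQ
θ-weight c d = 𝕚 ^ d ⊗ (c ⊖ fromℕ d)

θ-weight-+ : ∀ c m d → θ-weight c (m + d) ≡ 𝕚 ^ m ⊗ θ-weight (c ⊖ fromℕ m) d
θ-weight-+ c m d = begin
  𝕚 ^ (m + d) ⊗ (c ⊖ fromℕ (m + d))
    ≡⟨ cong₂ (λ P F → P ⊗ (c ⊖ F)) (^-homo-⊗ 𝕚 m d) (fromℕ-+ m d) ⟩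
  (𝕚 ^ m ⊗ 𝕚 ^ d) ⊗ (c ⊖ (fromℕ m ⊕ fromℕ d))
    ≡⟨ solve 5 (λ I J c M D → (I :* J) :* (c :- (M :+ D)) := I :* (J :* ((c :- M) :- D))) refl
         (𝕚 ^ m) (𝕚 ^ d) c (fromℕ m) (fromℕ d) ⟩
  𝕚 ^ m ⊗ (𝕚 ^ d ⊗ ((c ⊖ fromℕ m) ⊖ fromℕ d))  ∎
  where open ≡-Reasoning

f-at-2i : ∀ d → f d (𝕚 ⊖ inv 𝕚) ≡ θ-weight 𝟙 d
f-at-2i zero          = refl
f-at-2i (suc zero)    = refl
f-at-2i (suc (suc k)) = begin
  x ⊗ f (suc k) x ⊕ f k x
    ≡⟨ cong₂ (λ F₁ F₀ → x ⊗ F₁ ⊕ F₀) (f-at-2i (suc k)) (f-at-2i k) ⟩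
  x ⊗ ((𝕚 ⊗ I) ⊗ (𝟙 ⊖ fromℕ (suc k))) ⊕ I ⊗ (𝟙 ⊖ F)
    ≡⟨ cong (λ F₁ → x ⊗ ((𝕚 ⊗ I) ⊗ (𝟙 ⊖ F₁)) ⊕ I ⊗ (𝟙 ⊖ F)) (fromℕ-suc k) ⟩
  x ⊗ ((𝕚 ⊗ I) ⊗ (𝟙 ⊖ (𝟙 ⊕ F))) ⊕ I ⊗ (𝟙 ⊖ F)
    ≡⟨ solve 2 (λ I F → con x :* ((con 𝕚 :* I) :* (con 𝟙 :- (con 𝟙 :+ F))) :+ I :* (con 𝟙 :- F)
                     := (con 𝕚 :* (con 𝕚 :* I)) :* (con 𝟙 :- (con 𝟙 :+ (con 𝟙 :+ F)))) refl I F ⟩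
  (𝕚 ⊗ (𝕚 ⊗ I)) ⊗ (𝟙 ⊖ (𝟙 ⊕ (𝟙 ⊕ F)))
    ≡⟨ cong (λ F₂ → (𝕚 ⊗ (𝕚 ⊗ I)) ⊗ (𝟙 ⊖ F₂))
            (sym (trans (fromℕ-suc (suc k)) (cong (𝟙 ⊕_) (fromℕ-suc k)))) ⟩
  θ-weight 𝟙 (suc (suc k))  ∎
  where
  open ≡-Reasoning
  x I F : GQ
  x = 𝕚 ⊖ inv 𝕚
  I = 𝕚 ^ k
  F = fromℕ k

addAtEnds : ∀ {n} → Edge n → GQ → (Fin n → GQ) → Fin n → GQ
addAtEnds e x c v = c v ⊕ fromℕ (incidence e v) ⊗ x

addAtEnds-end : ∀ {n} (e : Edge n) x (c : Fin n → GQ) {v} → incidence e v ≡ 1 → addAtEnds e x c v ≡ c v ⊕ x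
addAtEnds-end e x c {v} end = trans (cong (λ k → c v ⊕ fromℕ k ⊗ x) end) (cong (c v ⊕_) (⊗-identityˡ x))

addAtEnds-off : ∀ {n} (e : Edge n) x (c : Fin n → GQ) {v} → incident v e ≡ false → addAtEnds e x c v ≡ c v
addAtEnds-off e x c {v} off = trans (cong (λ k → c v ⊕ fromℕ k ⊗ x) (incidence-off e {v} off))
                                    (solve 2 (λ c x → c :+ con 𝟘 :* x := c) refl (c v) x)

Θ-term : ∀ {n} → GQ → (Fin n → GQ) → List (Edge n) → GQ
Θ-term β c s = β ^ List.length s ⊗ ∏ (λ v → θ-weight (c v) (deg s v))

Θ : ∀ {n} → GQ → List (Edge n) → (Fin n → GQ) → GQ
Θ β E c = sumGQ (List.map (Θ-term β c) (subsets E))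

θ≡Θ : ∀ {n} (G : SimpleGraph n) β → θ G β 𝕚 ≡ Θ β (edges G) (λ _ → 𝟙)
θ≡Θ G β = cong sumGQ (map-cong (λ s → cong (β ^ List.length s ⊗_)
  (trans (foldr-map-allFin _⊗_ 𝟙 (λ v → f (deg s v) (𝕚 ⊖ inv 𝕚)))
         (∏-cong (λ v → f-at-2i (deg s v)))))
  (subsets (edges G)))

Θ-term-∷ : ∀ {n} β {a b : Fin n} → a ≢ b → ∀ c s →
  Θ-term β c ((a , b) ∷ s) ≡ ⊝ β ⊗ Θ-term β (addAtEnds (a , b) (⊝ 𝟙) c) s
Θ-term-∷ β {a} {b} a≢b c s = begin
  (β ⊗ B) ⊗ ∏ (λ v → θ-weight (c v) (deg (e ∷ s) v))
    ≡⟨ cong ((β ⊗ B) ⊗_) (∏-cong lower-charge) ⟩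
  (β ⊗ B) ⊗ ∏ (λ v → 𝕚 ^ incidence e v ⊗ θ-weight (c′ v) (deg s v))
    ≡⟨ cong ((β ⊗ B) ⊗_) (∏-distrib-⊗ (λ v → 𝕚 ^ incidence e v) (λ v → θ-weight (c′ v) (deg s v))) ⟩
  (β ⊗ B) ⊗ (∏ (λ v → 𝕚 ^ incidence e v) ⊗ P)
    ≡⟨ cong (λ I → (β ⊗ B) ⊗ (I ⊗ P)) (trans (∏-^ 𝕚 (incidence e)) (cong (𝕚 ^_) (Σ-incidence a≢b))) ⟩
  (β ⊗ B) ⊗ (⊝ 𝟙 ⊗ P)
    ≡⟨ solve 3 (λ β B P → (β :* B) :* ((:- con 𝟙) :* P) := (:- β) :* (B :* P)) refl β B P ⟩
  ⊝ β ⊗ (B ⊗ P)  ∎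
  where
  open ≡-Reasoning
  e = (a , b)
  c′ : _ → GQ
  c′ = addAtEnds e (⊝ 𝟙) c
  B P : GQ
  B = β ^ List.length s
  P = ∏ (λ v → θ-weight (c′ v) (deg s v))
  lower-charge : ∀ v → θ-weight (c v) (deg (e ∷ s) v) ≡ 𝕚 ^ incidence e v ⊗ θ-weight (c′ v) (deg s v)
  lower-charge v = begin
    θ-weight (c v) (deg (e ∷ s) v)
      ≡⟨ cong (θ-weight (c v)) (deg-∷ e s v) ⟩
    θ-weight (c v) (incidence e v + deg s v)
      ≡⟨ θ-weight-+ (c v) (incidence e v) (deg s v) ⟩
    𝕚 ^ incidence e v ⊗ θ-weight (c v ⊖ fromℕ (incidence e v)) (deg s v)
      ≡⟨ cong (λ c → 𝕚 ^ incidence e v ⊗ θ-weight c (deg s v))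
              (solve 2 (λ c D → c :- D := c :+ D :* (:- con 𝟙)) refl (c v) (fromℕ (incidence e v))) ⟩
    𝕚 ^ incidence e v ⊗ θ-weight (c′ v) (deg s v)  ∎

Θ-∷ : ∀ {n} β {a b : Fin n} → a ≢ b → ∀ E c →
  Θ β ((a , b) ∷ E) c ≡ Θ β E c ⊕ ⊝ β ⊗ Θ β E (addAtEnds (a , b) (⊝ 𝟙) c)
Θ-∷ β {a} {b} a≢b E c = begin
  Θ β (e ∷ E) c
    ≡⟨ sumGQ-subsets-∷ (Θ-term β c) e E ⟩
  sumGQ (List.map (λ s → Θ-term β c s ⊕ Θ-term β c (e ∷ s)) (subsets E))
    ≡⟨ cong sumGQ (map-cong (λ s → cong (Θ-term β c s ⊕_) (Θ-term-∷ β a≢b c s)) (subsets E)) ⟩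
  sumGQ (List.map (λ s → Θ-term β c s ⊕ ⊝ β ⊗ Θ-term β c′ s) (subsets E))
    ≡⟨ sumGQ-map-⊕ (Θ-term β c) (λ s → ⊝ β ⊗ Θ-term β c′ s) (subsets E) ⟩
  Θ β E c ⊕ sumGQ (List.map (λ s → ⊝ β ⊗ Θ-term β c′ s) (subsets E))
    ≡⟨ cong (Θ β E c ⊕_) (sumGQ-map-⊗ˡ (⊝ β) (Θ-term β c′) (subsets E)) ⟩
  Θ β E c ⊕ ⊝ β ⊗ Θ β E c′  ∎
  where
  open ≡-Reasoning
  e = (a , b)
  c′ : _ → GQ
  c′ = addAtEnds e (⊝ 𝟙) c

-- Charged matching sums

Φ-term : ∀ {n} → GQ → (Fin n → GQ) → List (Edge n) → GQ
Φ-term β A s = (⊝ β) ^ List.length s ⊗ ∏ (λ v → μ-weight (deg s v) (A v))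

Φ : ∀ {n} → GQ → List (Edge n) → (Fin n → GQ) → GQ
Φ β E A = sumGQ (List.map (Φ-term β A) (subsets E))

Φ-cong : ∀ {n} β (E : List (Edge n)) {A A′} → A ≗ A′ → Φ β E A ≡ Φ β E A′
Φ-cong β E A≗A′ = cong sumGQ (map-cong (λ s →
  cong ((⊝ β) ^ List.length s ⊗_) (∏-cong (λ v → cong (μ-weight (deg s v)) (A≗A′ v)))) (subsets E))

μ-weight-edge : ∀ β da db A B →
  (𝟙 ⊖ β) ⊗ (μ-weight da (A ⊕ β) ⊗ μ-weight db (B ⊕ β)
             ⊕ ⊝ β ⊗ (μ-weight (suc da) (A ⊕ β) ⊗ μ-weight (suc db) (B ⊕ β)))
  ≡ μ-weight da A ⊗ μ-weight db B
    ⊕ ⊝ β ⊗ (μ-weight da (A ⊖ (𝟙 ⊖ β)) ⊗ μ-weight db (B ⊖ (𝟙 ⊖ β)))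
μ-weight-edge β zero zero A B =
  solve 3 (λ β A B → (con 𝟙 :- β) :* ((A :+ β) :* (B :+ β) :+ (:- β) :* (con 𝟙 :* con 𝟙))
                   := A :* B :+ (:- β) :* ((A :- (con 𝟙 :- β)) :* (B :- (con 𝟙 :- β)))) refl β A B
μ-weight-edge β zero (suc zero) A B =
  solve 2 (λ β A → (con 𝟙 :- β) :* ((A :+ β) :* con 𝟙 :+ (:- β) :* (con 𝟙 :* con 𝟘))
                 := A :* con 𝟙 :+ (:- β) :* ((A :- (con 𝟙 :- β)) :* con 𝟙)) refl β A
μ-weight-edge β (suc zero) zero A B =
  solve 2 (λ β B → (con 𝟙 :- β) :* (con 𝟙 :* (B :+ β) :+ (:- β) :* (con 𝟘 :* con 𝟙))
                 := con 𝟙 :* B :+ (:- β) :* (con 𝟙 :* (B :- (con 𝟙 :- β)))) refl β B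
μ-weight-edge β (suc zero) (suc zero) A B =
  solve 1 (λ β → (con 𝟙 :- β) :* (con 𝟙 :* con 𝟙 :+ (:- β) :* (con 𝟘 :* con 𝟘))
               := con 𝟙 :* con 𝟙 :+ (:- β) :* (con 𝟙 :* con 𝟙)) refl β
μ-weight-edge β (suc (suc _)) db A B =
  solve 5 (λ β X Y Z W → (con 𝟙 :- β) :* (con 𝟘 :* X :+ (:- β) :* (con 𝟘 :* Y))
                       := con 𝟘 :* Z :+ (:- β) :* (con 𝟘 :* W)) refl
    β (μ-weight db (B ⊕ β)) (μ-weight (suc db) (B ⊕ β)) (μ-weight db B) (μ-weight db (B ⊖ (𝟙 ⊖ β)))
μ-weight-edge β zero (suc (suc _)) A B =
  solve 2 (λ β A → (con 𝟙 :- β) :* ((A :+ β) :* con 𝟘 :+ (:- β) :* (con 𝟙 :* con 𝟘))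
                 := A :* con 𝟘 :+ (:- β) :* ((A :- (con 𝟙 :- β)) :* con 𝟘)) refl β A
μ-weight-edge β (suc zero) (suc (suc _)) A B =
  solve 1 (λ β → (con 𝟙 :- β) :* (con 𝟙 :* con 𝟘 :+ (:- β) :* (con 𝟘 :* con 𝟘))
               := con 𝟙 :* con 𝟘 :+ (:- β) :* (con 𝟙 :* con 𝟘)) refl β

Φ-term-∷ : ∀ {n} β {a b : Fin n} → a ≢ b → ∀ A s →
  (𝟙 ⊖ β) ⊗ (Φ-term β (addAtEnds (a , b) β A) s ⊕ Φ-term β (addAtEnds (a , b) β A) ((a , b) ∷ s))
  ≡ Φ-term β A s ⊕ ⊝ β ⊗ Φ-term β (addAtEnds (a , b) (⊝ (𝟙 ⊖ β)) A) s
Φ-term-∷ β {a} {b} a≢b A s = begin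
  w ⊗ (Y ⊗ ∏ t₁ ⊕ (⊝ β ⊗ Y) ⊗ ∏ t₂)
    ≡⟨ cong₂ (λ P Q → w ⊗ (Y ⊗ P ⊕ (⊝ β ⊗ Y) ⊗ Q))
         (∏-edge a≢b (λ v off → cong (μ-weight (deg s v)) (addAtEnds-off e β A off))
                 (t₁-end a₁) (t₁-end b₁))
         (∏-edge a≢b (λ v off → cong₂ μ-weight (deg-∷-off e s {v} off) (addAtEnds-off e β A off))
                 (t₂-end a₁) (t₂-end b₁)) ⟩
  w ⊗ (Y ⊗ (p₁ ⊗ (p₂ ⊗ R)) ⊕ (⊝ β ⊗ Y) ⊗ (q₁ ⊗ (q₂ ⊗ R)))
    ≡⟨ solve 7 (λ β Y R p₁ p₂ q₁ q₂ →
                  (con 𝟙 :- β) :* (Y :* (p₁ :* (p₂ :* R)) :+ ((:- β) :* Y) :* (q₁ :* (q₂ :* R)))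
               := (Y :* R) :* ((con 𝟙 :- β) :* (p₁ :* p₂ :+ (:- β) :* (q₁ :* q₂)))) refl
         β Y R p₁ p₂ q₁ q₂ ⟩
  (Y ⊗ R) ⊗ (w ⊗ (p₁ ⊗ p₂ ⊕ ⊝ β ⊗ (q₁ ⊗ q₂)))
    ≡⟨ cong ((Y ⊗ R) ⊗_) (μ-weight-edge β (deg s a) (deg s b) (A a) (A b)) ⟩
  (Y ⊗ R) ⊗ (r₁ ⊗ r₂ ⊕ ⊝ β ⊗ (s₁ ⊗ s₂))
    ≡⟨ solve 7 (λ β Y R r₁ r₂ s₁ s₂ →
                  (Y :* R) :* (r₁ :* r₂ :+ (:- β) :* (s₁ :* s₂))
               := Y :* (r₁ :* (r₂ :* R)) :+ (:- β) :* (Y :* (s₁ :* (s₂ :* R)))) refl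
         β Y R r₁ r₂ s₁ s₂ ⟩
  Y ⊗ (r₁ ⊗ (r₂ ⊗ R)) ⊕ ⊝ β ⊗ (Y ⊗ (s₁ ⊗ (s₂ ⊗ R)))
    ≡⟨ sym (cong₂ (λ P Q → Y ⊗ P ⊕ ⊝ β ⊗ (Y ⊗ Q))
         (∏-edge a≢b (λ _ _ → refl) refl refl)
         (∏-edge a≢b (λ v off → cong (μ-weight (deg s v)) (addAtEnds-off e (⊝ w) A off))
                 (t₄-end a₁) (t₄-end b₁))) ⟩
  Y ⊗ ∏ t₃ ⊕ ⊝ β ⊗ (Y ⊗ ∏ t₄)  ∎
  where
  open ≡-Reasoning
  e = (a , b)
  a₁ : incidence e a ≡ 1
  a₁ = incidence-fst a b
  b₁ : incidence e b ≡ 1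
  b₁ = incidence-snd a b
  w Y : GQ
  w = 𝟙 ⊖ β
  Y = (⊝ β) ^ List.length s
  t₁ t₂ t₃ t₄ : _ → GQ
  t₁ v = μ-weight (deg s v) (addAtEnds e β A v)
  t₂ v = μ-weight (deg (e ∷ s) v) (addAtEnds e β A v)
  t₃ v = μ-weight (deg s v) (A v)
  t₄ v = μ-weight (deg s v) (addAtEnds e (⊝ w) A v)
  t₁-end : ∀ {v} → incidence e v ≡ 1 → t₁ v ≡ μ-weight (deg s v) (A v ⊕ β)
  t₁-end end = cong (μ-weight _) (addAtEnds-end e β A end)
  t₂-end : ∀ {v} → incidence e v ≡ 1 → t₂ v ≡ μ-weight (suc (deg s v)) (A v ⊕ β)
  t₂-end {v} end = cong₂ μ-weight (deg-∷-end e s {v} end) (addAtEnds-end e β A end)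
  t₄-end : ∀ {v} → incidence e v ≡ 1 → t₄ v ≡ μ-weight (deg s v) (A v ⊖ w)
  t₄-end end = cong (μ-weight _) (addAtEnds-end e (⊝ w) A end)
  R p₁ p₂ q₁ q₂ r₁ r₂ s₁ s₂ : GQ
  R  = ∏ (offEdge e 𝟙 t₃)
  p₁ = μ-weight (deg s a) (A a ⊕ β)
  p₂ = μ-weight (deg s b) (A b ⊕ β)
  q₁ = μ-weight (suc (deg s a)) (A a ⊕ β)
  q₂ = μ-weight (suc (deg s b)) (A b ⊕ β)
  r₁ = μ-weight (deg s a) (A a)
  r₂ = μ-weight (deg s b) (A b)
  s₁ = μ-weight (deg s a) (A a ⊖ w)
  s₂ = μ-weight (deg s b) (A b ⊖ w)

Φ-∷ : ∀ {n} β {a b : Fin n} → a ≢ b → ∀ E A →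
  (𝟙 ⊖ β) ⊗ Φ β ((a , b) ∷ E) (addAtEnds (a , b) β A)
  ≡ Φ β E A ⊕ ⊝ β ⊗ Φ β E (addAtEnds (a , b) (⊝ (𝟙 ⊖ β)) A)
Φ-∷ β {a} {b} a≢b E A = begin
  (𝟙 ⊖ β) ⊗ Φ β (e ∷ E) A⁺
    ≡⟨ cong ((𝟙 ⊖ β) ⊗_) (sumGQ-subsets-∷ (Φ-term β A⁺) e E) ⟩
  (𝟙 ⊖ β) ⊗ sumGQ (List.map (λ s → Φ-term β A⁺ s ⊕ Φ-term β A⁺ (e ∷ s)) (subsets E))
    ≡⟨ sym (sumGQ-map-⊗ˡ (𝟙 ⊖ β) (λ s → Φ-term β A⁺ s ⊕ Φ-term β A⁺ (e ∷ s)) (subsets E)) ⟩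
  sumGQ (List.map (λ s → (𝟙 ⊖ β) ⊗ (Φ-term β A⁺ s ⊕ Φ-term β A⁺ (e ∷ s))) (subsets E))
    ≡⟨ cong sumGQ (map-cong (Φ-term-∷ β a≢b A) (subsets E)) ⟩
  sumGQ (List.map (λ s → Φ-term β A s ⊕ ⊝ β ⊗ Φ-term β A⁻ s) (subsets E))
    ≡⟨ sumGQ-map-⊕ (Φ-term β A) (λ s → ⊝ β ⊗ Φ-term β A⁻ s) (subsets E) ⟩
  Φ β E A ⊕ sumGQ (List.map (λ s → ⊝ β ⊗ Φ-term β A⁻ s) (subsets E))
    ≡⟨ cong (Φ β E A ⊕_) (sumGQ-map-⊗ˡ (⊝ β) (Φ-term β A⁻) (subsets E)) ⟩
  Φ β E A ⊕ ⊝ β ⊗ Φ β E A⁻  ∎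
  where
  open ≡-Reasoning
  e = (a , b)
  A⁺ A⁻ : _ → GQ
  A⁺ = addAtEnds e β A
  A⁻ = addAtEnds e (⊝ (𝟙 ⊖ β)) A

-- The charged θ-sum is a charged matching sum

charge : ∀ {n} → GQ → List (Edge n) → (Fin n → GQ) → Fin n → GQ
charge β E c v = (𝟙 ⊖ β) ⊗ c v ⊕ fromℕ (deg E v) ⊗ β

charge-∷ : ∀ {n} β (e : Edge n) E c → charge β (e ∷ E) c ≗ addAtEnds e β (charge β E c)
charge-∷ β e E c v = begin
  (𝟙 ⊖ β) ⊗ c v ⊕ fromℕ (deg (e ∷ E) v) ⊗ β
    ≡⟨ cong (λ F → (𝟙 ⊖ β) ⊗ c v ⊕ F ⊗ β)
            (trans (cong fromℕ (deg-∷ e E v)) (fromℕ-+ (incidence e v) (deg E v))) ⟩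
  (𝟙 ⊖ β) ⊗ c v ⊕ (I ⊕ D) ⊗ β
    ≡⟨ solve 4 (λ β c I D → (con 𝟙 :- β) :* c :+ (I :+ D) :* β
                         := ((con 𝟙 :- β) :* c :+ D :* β) :+ I :* β) refl β (c v) I D ⟩
  ((𝟙 ⊖ β) ⊗ c v ⊕ D ⊗ β) ⊕ I ⊗ β  ∎
  where
  open ≡-Reasoning
  I D : GQ
  I = fromℕ (incidence e v)
  D = fromℕ (deg E v)

charge-addAtEnds : ∀ {n} β (e : Edge n) E c →
  charge β E (addAtEnds e (⊝ 𝟙) c) ≗ addAtEnds e (⊝ (𝟙 ⊖ β)) (charge β E c)
charge-addAtEnds β e E c v =
  solve 4 (λ β c I D → (con 𝟙 :- β) :* (c :+ I :* (:- con 𝟙)) :+ D :* β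
                     := ((con 𝟙 :- β) :* c :+ D :* β) :+ I :* (:- (con 𝟙 :- β))) refl
    β (c v) (fromℕ (incidence e v)) (fromℕ (deg E v))

Θ≡Φ-[] : ∀ {n} β (c : Fin n → GQ) → (𝟙 ⊖ β) ^ n ⊗ Θ β [] c ≡ 𝟙 ⊗ Φ β [] (charge β [] c)
Θ≡Φ-[] {n} β c = begin
  w ^ n ⊗ (𝟙 ⊗ P ⊕ 𝟘)
    ≡⟨ solve 2 (λ W P → W :* (con 𝟙 :* P :+ con 𝟘) := con 𝟙 :* (con 𝟙 :* (W :* P) :+ con 𝟘)) refl
         (w ^ n) P ⟩
  𝟙 ⊗ (𝟙 ⊗ (w ^ n ⊗ P) ⊕ 𝟘)
    ≡⟨ cong (λ Q → 𝟙 ⊗ (𝟙 ⊗ Q ⊕ 𝟘)) (begin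
      w ^ n ⊗ P                           ≡⟨ cong (_⊗ P) (sym (∏-const n w)) ⟩
      ∏ {n} (λ _ → w) ⊗ P
        ≡⟨ sym (∏-distrib-⊗ {n} (λ _ → w) (λ v → θ-weight (c v) 0)) ⟩
      ∏ (λ v → w ⊗ θ-weight (c v) 0)
        ≡⟨ ∏-cong (λ v → solve 3 (λ w c β → w :* (con 𝟙 :* (c :- con 𝟘)) := w :* c :+ con 𝟘 :* β) refl
                                 w (c v) β) ⟩
      ∏ (charge β [] c)  ∎) ⟩
  𝟙 ⊗ Φ β [] (charge β [] c)  ∎
  where
  open ≡-Reasoning
  w P : GQ
  w = 𝟙 ⊖ β
  P = ∏ (λ v → θ-weight (c v) 0)

Θ≡Φ : ∀ {n} β (E : List (Edge n)) → All Proper E → ∀ c →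
  (𝟙 ⊖ β) ^ n ⊗ Θ β E c ≡ (𝟙 ⊖ β) ^ List.length E ⊗ Φ β E (charge β E c)
Θ≡Φ β []              []             c = Θ≡Φ-[] β c
Θ≡Φ {n} β ((a , b) ∷ E) (a≢b ∷ proper) c = begin
  w ^ n ⊗ Θ β (e ∷ E) c
    ≡⟨ cong (w ^ n ⊗_) (Θ-∷ β a≢b E c) ⟩
  w ^ n ⊗ (Θ β E c ⊕ ⊝ β ⊗ Θ β E c′)
    ≡⟨ solve 4 (λ W T β T′ → W :* (T :+ (:- β) :* T′) := W :* T :+ (:- β) :* (W :* T′)) refl
         (w ^ n) (Θ β E c) β (Θ β E c′) ⟩
  w ^ n ⊗ Θ β E c ⊕ ⊝ β ⊗ (w ^ n ⊗ Θ β E c′)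
    ≡⟨ cong₂ (λ X Y → X ⊕ ⊝ β ⊗ Y) (Θ≡Φ β E proper c) (Θ≡Φ β E proper c′) ⟩
  W ⊗ Φ β E A ⊕ ⊝ β ⊗ (W ⊗ Φ β E (charge β E c′))
    ≡⟨ cong (λ X → W ⊗ Φ β E A ⊕ ⊝ β ⊗ (W ⊗ X)) (Φ-cong β E (charge-addAtEnds β e E c)) ⟩
  W ⊗ Φ β E A ⊕ ⊝ β ⊗ (W ⊗ Φ β E A⁻)
    ≡⟨ solve 4 (λ W X β Y → W :* X :+ (:- β) :* (W :* Y) := W :* (X :+ (:- β) :* Y)) refl
         W (Φ β E A) β (Φ β E A⁻) ⟩
  W ⊗ (Φ β E A ⊕ ⊝ β ⊗ Φ β E A⁻)
    ≡⟨ cong (W ⊗_) (sym (Φ-∷ β a≢b E A)) ⟩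
  W ⊗ (w ⊗ Φ β (e ∷ E) A⁺)
    ≡⟨ solve 3 (λ W w X → W :* (w :* X) := (w :* W) :* X) refl W w (Φ β (e ∷ E) A⁺) ⟩
  (w ⊗ W) ⊗ Φ β (e ∷ E) A⁺
    ≡⟨ cong ((w ⊗ W) ⊗_) (sym (Φ-cong β (e ∷ E) (charge-∷ β e E c))) ⟩
  (w ⊗ W) ⊗ Φ β (e ∷ E) (charge β (e ∷ E) c)  ∎
  where
  open ≡-Reasoning
  e = (a , b)
  w W : GQ
  w = 𝟙 ⊖ β
  W = w ^ List.length E
  c′ A A⁺ A⁻ : _ → GQ
  c′ = addAtEnds e (⊝ 𝟙) c
  A  = charge β E c
  A⁺ = addAtEnds e β A
  A⁻ = addAtEnds e (⊝ w) A

-- Regular graphs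

regular-charge : ∀ {n q} (G : SimpleGraph n) → Regular G (suc q) → ∀ {u} → u ≢ 𝟘 →
  charge (u ⊗ u) (edges G) (λ _ → 𝟙) ≗ λ _ → (inv u ⊕ fromℕ q ⊗ u) ⊗ u
regular-charge {q = q} G regular {u} u≢0 v = begin
  (𝟙 ⊖ u ⊗ u) ⊗ 𝟙 ⊕ fromℕ (degree G v) ⊗ (u ⊗ u)
    ≡⟨ cong (λ d → (𝟙 ⊖ u ⊗ u) ⊗ 𝟙 ⊕ fromℕ d ⊗ (u ⊗ u)) (regular v) ⟩
  (𝟙 ⊖ u ⊗ u) ⊗ 𝟙 ⊕ fromℕ (suc q) ⊗ (u ⊗ u)
    ≡⟨ cong (λ F → (𝟙 ⊖ u ⊗ u) ⊗ 𝟙 ⊕ F ⊗ (u ⊗ u)) (fromℕ-suc q) ⟩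
  (𝟙 ⊖ u ⊗ u) ⊗ 𝟙 ⊕ (𝟙 ⊕ Q) ⊗ (u ⊗ u)
    ≡⟨ solve 2 (λ u Q → (con 𝟙 :- u :* u) :* con 𝟙 :+ (con 𝟙 :+ Q) :* (u :* u)
                     := con 𝟙 :+ Q :* (u :* u)) refl u Q ⟩
  𝟙 ⊕ Q ⊗ (u ⊗ u)
    ≡⟨ cong (_⊕ Q ⊗ (u ⊗ u)) (sym (inv-inverseˡ u u≢0)) ⟩
  inv u ⊗ u ⊕ Q ⊗ (u ⊗ u)
    ≡⟨ solve 3 (λ ι u Q → ι :* u :+ Q :* (u :* u) := (ι :+ Q :* u) :* u) refl (inv u) u Q ⟩
  (inv u ⊕ Q ⊗ u) ⊗ u  ∎
  where
  open ≡-Reasoning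
  Q : GQ
  Q = fromℕ q

Φ-matchings : ∀ {n} (G : SimpleGraph n) β z →
  Φ β (edges G) (λ _ → z)
  ≡ sumGQ (List.map (λ k → fromℕ (p G k) ⊗ ((⊝ β) ^ k ⊗ z ^ (n ∸ 2 ℕ.* k))) (upTo (suc ⌊ n /2⌋)))
Φ-matchings {n} G β z = begin
  Φ β (edges G) (λ _ → z)
    ≡⟨ cong sumGQ (map-cong-local (All.map term proper-subsets)) ⟩
  sumGQ (List.map (λ s → if IsMatching s then F (List.length s) else 𝟘) (subsets (edges G)))
    ≡⟨ sumGQ-fibres IsMatching List.length F (subsets (edges G)) (All.map bound proper-subsets) ⟩
  sumGQ (List.map (λ k → fromℕ (p G k) ⊗ F k) (upTo (suc ⌊ n /2⌋)))  ∎
  where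
  open ≡-Reasoning
  F : ℕ → GQ
  F k = (⊝ β) ^ k ⊗ z ^ (n ∸ 2 ℕ.* k)
  proper-subsets : All (All Proper) (subsets (edges G))
  proper-subsets = subsets⁺ (edges-proper G)
  term : ∀ {s} → All Proper s → Φ-term β (λ _ → z) s ≡ (if IsMatching s then F (List.length s) else 𝟘)
  term {s} proper = begin
    Y ⊗ ∏ (λ v → μ-weight (deg s v) z)        ≡⟨ cong (Y ⊗_) (∏-μ-weight-deg s proper z) ⟩
    Y ⊗ (if IsMatching s then Z else 𝟘)       ≡⟨ if-float (Y ⊗_) (IsMatching s) ⟩
    (if IsMatching s then Y ⊗ Z else Y ⊗ 𝟘)   ≡⟨ cong (if IsMatching s then Y ⊗ Z else_) (⊗-zeroʳ Y) ⟩
    (if IsMatching s then Y ⊗ Z else 𝟘)       ∎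
    where
    Y Z : GQ
    Y = (⊝ β) ^ List.length s
    Z = z ^ (n ∸ 2 ℕ.* List.length s)
  bound : ∀ {s} → All Proper s → IsMatching s ≡ true → List.length s < suc ⌊ n /2⌋
  bound {s} proper matching = s≤s (matching-size s proper matching)

α-⊗-^ : ∀ {n} (G : SimpleGraph n) x u →
  α G x ⊗ u ^ n
  ≡ sumGQ (List.map (λ k → fromℕ (p G k) ⊗ ((⊝ (u ⊗ u)) ^ k ⊗ (x ⊗ u) ^ (n ∸ 2 ℕ.* k)))
                    (upTo (suc ⌊ n /2⌋)))
α-⊗-^ {n} G x u = begin
  sumGQ (List.map T (upTo N)) ⊗ u ^ n
    ≡⟨ ⊗-comm (sumGQ (List.map T (upTo N))) (u ^ n) ⟩
  u ^ n ⊗ sumGQ (List.map T (upTo N))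
    ≡⟨ sym (sumGQ-map-⊗ˡ (u ^ n) T (upTo N)) ⟩
  sumGQ (List.map (λ k → u ^ n ⊗ T k) (upTo N))
    ≡⟨ cong sumGQ (map-cong-local (All.map (λ k<N → term (double-≤ (ℕₚ.≤-pred k<N))) (all-upTo N))) ⟩
  sumGQ (List.map (λ k → fromℕ (p G k) ⊗ ((⊝ (u ⊗ u)) ^ k ⊗ (x ⊗ u) ^ (n ∸ 2 ℕ.* k))) (upTo N))  ∎
  where
  open ≡-Reasoning
  N : ℕ
  N = suc ⌊ n /2⌋
  T : ℕ → GQ
  T k = sgn k ⊗ fromℕ (p G k) ⊗ x ^ (n ∸ 2 ℕ.* k)
  term : ∀ {k} → 2 ℕ.* k ≤ n →
    u ^ n ⊗ T k ≡ fromℕ (p G k) ⊗ ((⊝ (u ⊗ u)) ^ k ⊗ (x ⊗ u) ^ (n ∸ 2 ℕ.* k))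
  term {k} 2k≤n = begin
    u ^ n ⊗ (S ⊗ P ⊗ x ^ m)
      ≡⟨ cong (λ j → u ^ j ⊗ (S ⊗ P ⊗ x ^ m)) (sym (ℕₚ.m∸n+n≡m 2k≤n)) ⟩
    u ^ (m + 2 ℕ.* k) ⊗ (S ⊗ P ⊗ x ^ m)
      ≡⟨ cong (_⊗ (S ⊗ P ⊗ x ^ m)) (trans (^-homo-⊗ u m (2 ℕ.* k)) (cong (u ^ m ⊗_) (^-double u k))) ⟩
    (u ^ m ⊗ (u ⊗ u) ^ k) ⊗ (S ⊗ P ⊗ x ^ m)
      ≡⟨ solve 5 (λ U V S P X → (U :* V) :* (S :* P :* X) := P :* ((S :* V) :* (X :* U))) refl
           (u ^ m) ((u ⊗ u) ^ k) S P (x ^ m) ⟩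
    P ⊗ ((S ⊗ (u ⊗ u) ^ k) ⊗ (x ^ m ⊗ u ^ m))
      ≡⟨ cong₂ (λ V W → P ⊗ (V ⊗ W)) (sym (^-distrib-⊗ (⊝ 𝟙) (u ⊗ u) k))
                                      (sym (^-distrib-⊗ x u m)) ⟩
    P ⊗ ((⊝ 𝟙 ⊗ (u ⊗ u)) ^ k ⊗ (x ⊗ u) ^ m)
      ≡⟨ cong (λ y → P ⊗ (y ^ k ⊗ (x ⊗ u) ^ m))
              (solve 1 (λ β → (:- con 𝟙) :* β := :- β) refl (u ⊗ u)) ⟩
    P ⊗ ((⊝ (u ⊗ u)) ^ k ⊗ (x ⊗ u) ^ m)  ∎
    where
    S P : GQ
    S = sgn k
    P = fromℕ (p G k)
    m : ℕ
    m = n ∸ 2 ℕ.* k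

corollary2 : (n q : ℕ) (G : SimpleGraph n) → Connected G → Regular G (suc q) →
    (u : GQ) → u ≢ 𝟘 → u ⊗ u ≢ 𝟙 →
    ω G (u ⊗ u) ≡ α G (inv u ⊕ fromℕ q ⊗ u) ⊗ (u ^ n)
corollary2 n q G _ regular u u≢0 u²≢1 =
  ^m⊗X≡^k⊗Y⇒X⊗^ℤ[m-k]≡Y (𝟙⊖≢𝟘 u²≢1) n (List.length E) (begin
    w ^ n ⊗ θ G β 𝕚                                    ≡⟨ cong (w ^ n ⊗_) (θ≡Θ G β) ⟩
    w ^ n ⊗ Θ β E (λ _ → 𝟙)                            ≡⟨ Θ≡Φ β E (edges-proper G) (λ _ → 𝟙) ⟩
    w ^ List.length E ⊗ Φ β E (charge β E (λ _ → 𝟙))   ≡⟨ cong (w ^ List.length E ⊗_) (begin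
      Φ β E (charge β E (λ _ → 𝟙))                        ≡⟨ Φ-cong β E (regular-charge G regular u≢0) ⟩
      Φ β E (λ _ → x ⊗ u)                                 ≡⟨ Φ-matchings G β (x ⊗ u) ⟩
      matchings                                           ≡⟨ sym (α-⊗-^ G x u) ⟩
      α G x ⊗ u ^ n                                       ∎) ⟩
    w ^ List.length E ⊗ (α G x ⊗ u ^ n)                ∎)
  where
  open ≡-Reasoning
  β w x matchings : GQ
  β = u ⊗ u
  w = 𝟙 ⊖ β
  x = inv u ⊕ fromℕ q ⊗ u
  matchings = sumGQ (List.map (λ k → fromℕ (p G k) ⊗ ((⊝ β) ^ k ⊗ (x ⊗ u) ^ (n ∸ 2 ℕ.* k)))
                              (upTo (suc ⌊ n /2⌋)))
  E : List (Edge n)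
  E = edges G
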